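{- Let $A_t$ and $\mathsf{type}$ be as in the context, and let $Q_t$ be the $2t\times 2$ 0--1 matrix whose first row is $(1,1)$, whose rows $2,4,\dots,2t$ have a single 1, in column 2, and whose rows $3,5,\dots,2t-1$ have a single 1, in column 1 (equivalently, $Q_t$ is the reflection across the minor diagonal of the $2\times 2t$ matrix with first row having 1s exactly in columns $1,3,\dots,2t-1,2t$ and second row having 1s exactly in columns $2,4,\dots,2t-2,2t$). Consider an occurrence of $Q_t$ in $A_t$, i.e. rows $a=r_1<r_2<\cdots<r_{2t}=b$ and columns $c<d$ of $A_t$ (all in $\mathcal{I}$) such that $Q_t(i,1)=1$ implies $A_t(r_i,c)=1$ and $Q_t(i,2)=1$ implies $A_t(r_i,d)=1$. If $\mathsf{type}(a,b)\ge\mathsf{type}(c,d)$, then $\mathsf{type}(a,b)=\mathsf{type}(c,d)=1$.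
   Context: Let $[k]=\{1,\dots,k\}$, $t\ge 2$ a fixed integer and $k$ a positive integer. Let $\mathcal{I}=[k^t]^{tk}$; an element $a\in\mathcal{I}$ is viewed as $t$ consecutive blocks of length $k$, $a(p)$ denotes its $p$-th block and $a(p,q)$ the $q$-th coordinate of the $p$-th block. $\mathcal{I}$ is ordered lexicographically. For $r\ge 0$ and $(j_1,\dots,j_r)\in[k]^r$ let $\langle j_1,\dots,j_r\rangle=1+\sum_{s=1}^r (j_s-1)k^{r-s}$ (with $\langle\ \rangle=1$). For $(j_1,\dots,j_t)\in[k]^t$, $\mathbf{v}[j_1,\dots,j_t]\in\mathbb{Z}^{tk}$ is $0$ in every coordinate except that coordinate $(r,j_r)$ equals $\langle j_1,\dots,j_{r-1}\rangle$ for each $r\in[t]$; $\mathcal{S}$ is the set of all such vectors. $A_t$ is the 0--1 matrix with rows and columns indexed by $\mathcal{I}$ in lexicographic order, $A_t(a,b)=1$ iff $b-a\in\mathcal{S}$. For distinct $a,b\in\mathcal{I}$, $\mathsf{type}(a,b)=\min\{r : a(r)\ne b(r)\}$. -}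

module Defs where

open import Data.Nat using (ℕ; zero; suc; _+_; _*_; _^_; _≤_)
open import Data.Fin as Fin using (Fin; toℕ)
open import Data.Bool using (Bool; true; false; if_then_else_)
open import Data.List as List using (List; []; _∷_; length)
open import Data.Product using (Σ; ∃; _×_)
open import Data.Sum using (_⊎_)
open import Relation.Binary.PropositionalEquality using (_≡_)
open import Relation.Nullary using (¬_; does)

-- Conventions: all indices are 0-based.  Block p ∈ Fin t corresponds to the
-- paper's block p+1, coordinate q ∈ Fin k to the paper's coordinate q+1.
-- An element of ℐ = [k^t]^{tk} is a function a : Fin t → Fin k → ℕ
-- (a p q = a(p+1,q+1)) with all entries in {1,…,k^t}.

Elt : ℕ → ℕ → Set
Elt t k = Fin t → Fin k → ℕ

InI : (t k : ℕ) → Elt t k → Set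
InI t k a = ∀ p q → 1 ≤ a p q × a p q ≤ k ^ t

_<lex_ : ∀ {t k} → Elt t k → Elt t k → Set
_<lex_ {t} {k} a b =
  Σ (Fin t) λ p → Σ (Fin k) λ q →
    (∀ (p' : Fin t) (q' : Fin k) → (p' Fin.< p ⊎ (p' ≡ p × q' Fin.< q)) → a p' q' ≡ b p' q')
    × a p q Data.Nat.< b p q

angleSum : ℕ → List ℕ → ℕ
angleSum k [] = 0
angleSum k (x ∷ xs) = x * k ^ length xs + angleSum k xs

-- ⟨j₁,…,j_r⟩ = 1 + Σ_{s=1}^r (j_s - 1) k^{r-s}, input given as (j_s - 1)'s.
angle : ℕ → List ℕ → ℕ
angle k js = 1 + angleSum k js

-- j : Fin t → Fin k encodes (j₁,…,j_t) via toℕ (j s) = j_{s+1} - 1.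
-- v[j] at coordinate (p,q) is ⟨j₁,…,j_p⟩ (paper indices: ⟨j_1..j_{r-1}⟩ at (r,j_r))
-- if q = j p, and 0 otherwise.
vecS : ∀ {t k} → (Fin t → Fin k) → Elt t k
vecS {t} {k} j p q =
  if does (q Fin.≟ j p)
  then angle k (List.map (λ s → toℕ (j s)) (List.take (toℕ p) (List.allFin t)))
  else 0

-- A_t(a,b) = 1  iff  b - a ∈ 𝒮.
Adj : ∀ {t k} → Elt t k → Elt t k → Set
Adj {t} {k} a b = Σ (Fin t → Fin k) λ j → ∀ p q → b p q ≡ a p q + vecS j p q

-- IsType a b r : type(a,b) = r (0-based), i.e. r is the least block index
-- in which a and b differ.
IsType : ∀ {t k} → Elt t k → Elt t k → Fin t → Set
IsType {t} {k} a b r =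
  (¬ (∀ q → a r q ≡ b r q)) × (∀ (r' : Fin t) → r' Fin.< r → ∀ q → a r' q ≡ b r' q)

-- Q_t, rows 0-based (row i here = paper row i+1), columns: zero = column 1,
-- suc zero = column 2.  Row 0: (1,1); paper rows 2,4,…,2t (0-based odd):
-- column 2 only; paper rows 3,5,…,2t-1 (0-based even ≥ 2): column 1 only.
Qrest : ℕ → Fin 2 → Bool
Qrest zero Fin.zero = false
Qrest zero (Fin.suc _) = true
Qrest (suc zero) Fin.zero = true
Qrest (suc zero) (Fin.suc _) = false
Qrest (suc (suc i)) c = Qrest i c

Q : ℕ → Fin 2 → Bool
Q zero _ = true
Q (suc i) c = Qrest i c

-- Let r₀ be the first row, with c = r₀ + v[J] and d = r₀ + v[J′].  If some row r
-- agrees with r₀ on the blocks before N but not on block N, then r exceeds r₀ for the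
-- first time at coordinate (N, J N) by ⟨J₁,…,J_N⟩ when r + v = c, and at (N, J′ N)
-- by ⟨J′₁,…,J′_N⟩ when r + v = d.  As long as N is not before type(c,d) these two keys
-- differ (a base-k expansion determines its digits), so all c-rows diverging at N lie
-- on the same side of all d-rows diverging at N.  The rows of Q_t alternate between
-- d-rows and c-rows, hence of three consecutive rows d, c, d at most the last one can
-- diverge from r₀ at N.  Going backwards from row 2t, which agrees with r₀ on
-- type(a,b) - 1 blocks, each of the rows 2t - 2, …, 4, 2 agrees with r₀ on one block
-- more than the next one; so row 2 agrees with r₀ on at least type(a,b) + t - 2
-- blocks.  It is larger than r₀, which forces type(a,b) = 1.
module Submission where

open import Defs
open import Data.Nat using (ℕ; zero; suc; _≤_; _<_; _*_; _+_; _^_; z≤n; s≤s; _<?_; _≟_)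
open import Data.Nat.Properties
open import Data.Nat.Tactic.RingSolver using (solve-∀)
open import Data.Fin as Fin using (Fin; toℕ; zero; suc; fromℕ<)
open import Data.Fin.Properties using (toℕ-injective; toℕ-fromℕ<; toℕ<n; all?)
  renaming (<-cmp to <-cmpᶠ; <⇒≢ to <⇒≢ᶠ; <-isStrictTotalOrder to <ᶠ-isStrictTotalOrder)
open import Data.Bool using (true)
open import Data.Product using (_×_; _,_; proj₁; proj₂; Σ)
open import Data.Product.Relation.Binary.Lex.Strict using (×-Lex; ×-isStrictTotalOrder)
open import Data.Sum using (_⊎_; inj₁; inj₂)
open import Data.Empty using (⊥-elim)
open import Data.List as List using (List; []; _∷_; length)
open import Data.List.Properties using (length-map; map-cong-local)
open import Data.List.Relation.Unary.All using (All; []; _∷_)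
open import Function using (_∘_; id)
open import Relation.Binary.PropositionalEquality
open import Relation.Binary.Structures using (IsStrictTotalOrder)
open import Relation.Binary.Definitions using (tri<; tri≈; tri>)
open import Relation.Nullary using (¬_; yes; no)
open import Relation.Nullary.Decidable using (dec-true; dec-false; decidable-stable)

*+-< : ∀ {m m′ n o} → m < m′ → o < n → m * n + o < m′ * n
*+-< {m} {m′} {n} {o} m<m′ o<n = begin-strict
  m * n + o  <⟨ +-monoʳ-< (m * n) o<n ⟩
  m * n + n  ≡⟨ +-comm (m * n) n ⟩
  suc m * n  ≤⟨ *-monoˡ-≤ n m<m′ ⟩
  m′ * n     ∎
  where open ≤-Reasoning

quotient-remainder-unique : ∀ {m m′ n o o′} → o < n → o′ < n →
  m * n + o ≡ m′ * n + o′ → m ≡ m′ × o ≡ o′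
quotient-remainder-unique {m} {m′} {n} {o} {o′} o<n o′<n eq with <-cmp m m′
... | tri< m<m′ _ _ = ⊥-elim (<⇒≢ (<-≤-trans (*+-< m<m′ o<n) (m≤m+n (m′ * n) o′)) eq)
... | tri≈ _ refl _ = refl , +-cancelˡ-≡ (m * n) o o′ eq
... | tri> _ _ m>m′ = ⊥-elim (<⇒≢ (<-≤-trans (*+-< m>m′ o′<n) (m≤m+n (m * n) o)) (sym eq))

module _ {A : Set} {k : ℕ} where

  digits : (A → Fin k) → List A → List ℕ
  digits f = List.map (λ s → toℕ (f s))

  angleSum-< : ∀ (f : A → Fin k) xs → angleSum k (digits f xs) < k ^ length xs
  angleSum-< f [] = s≤s z≤n
  angleSum-< f (x ∷ xs) rewrite length-map (λ s → toℕ (f s)) xs =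
    *+-< (toℕ<n (f x)) (angleSum-< f xs)

  angleSum-injective : ∀ (f g : A → Fin k) xs →
    angleSum k (digits f xs) ≡ angleSum k (digits g xs) → All (λ x → f x ≡ g x) xs
  angleSum-injective f g [] _ = []
  angleSum-injective f g (x ∷ xs) eq
    rewrite length-map (λ s → toℕ (f s)) xs | length-map (λ s → toℕ (g s)) xs
    with quotient-remainder-unique (angleSum-< f xs) (angleSum-< g xs) eq
  ... | fx≡gx , rest≡ = toℕ-injective fx≡gx ∷ angleSum-injective f g xs rest≡

module _ {A : Set} {P : A → Set} where

  All-take-tabulate⁺ : ∀ {t} n (h : Fin t → A) →
    (∀ p → toℕ p < n → P (h p)) → All P (List.take n (List.tabulate h))
  All-take-tabulate⁺ zero h _ = []
  All-take-tabulate⁺ {zero} (suc n) h _ = []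
  All-take-tabulate⁺ {suc t} (suc n) h Ph =
    Ph zero (s≤s z≤n) ∷ All-take-tabulate⁺ n (h ∘ suc) (λ p p<n → Ph (suc p) (s≤s p<n))

  All-take-tabulate⁻ : ∀ {t} n (h : Fin t → A) →
    All P (List.take n (List.tabulate h)) → ∀ p → toℕ p < n → P (h p)
  All-take-tabulate⁻ (suc n) h (Ph₀ ∷ _) zero _ = Ph₀
  All-take-tabulate⁻ (suc n) h (_ ∷ Phs) (suc p) (s≤s p<n) =
    All-take-tabulate⁻ n (h ∘ suc) Phs p p<n

module _ {t k : ℕ} where

  height : (Fin t → Fin k) → Fin t → ℕ
  height j p = angle k (digits j (List.take (toℕ p) (List.allFin t)))

  height-cong : ∀ {j j′ N} → (∀ p → toℕ p < toℕ N → j p ≡ j′ p) → height j N ≡ height j′ N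
  height-cong {N = N} j≡j′ = cong (angle k) (map-cong-local
    (All-take-tabulate⁺ (toℕ N) id (λ p p<N → cong toℕ (j≡j′ p p<N))))

  height-injective : ∀ {j j′ N} → height j N ≡ height j′ N → ∀ p → toℕ p < toℕ N → j p ≡ j′ p
  height-injective {j} {j′} {N} eq =
    All-take-tabulate⁻ (toℕ N) id (angleSum-injective j j′ _ (suc-injective eq))

  vecS-on : ∀ (j : Fin t → Fin k) p → vecS j p (j p) ≡ height j p
  vecS-on j p rewrite dec-true (j p Fin.≟ j p) refl = refl

  vecS-off : ∀ (j : Fin t → Fin k) {p q} → q ≢ j p → vecS j p q ≡ 0
  vecS-off j {p} {q} q≢jp rewrite dec-false (q Fin.≟ j p) q≢jp = refl

  vecS-block-cong : ∀ {j j′ p} → j p ≡ j′ p → height j p ≡ height j′ p →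
    ∀ q → vecS j p q ≡ vecS j′ p q
  vecS-block-cong {j} {j′} {p} jp≡ h≡ q with q Fin.≟ j p | q Fin.≟ j′ p
  ... | yes _ | yes _ = h≡
  ... | no _ | no _ = refl
  ... | yes q≡ | no q≢ = ⊥-elim (q≢ (trans q≡ jp≡))
  ... | no q≢ | yes q≡ = ⊥-elim (q≢ (trans q≡ (sym jp≡)))

  vecS-block-injective : ∀ {j j′ p} → (∀ q → vecS j p q ≡ vecS j′ p q) → j p ≡ j′ p
  vecS-block-injective {j} {j′} {p} v≡ with j p Fin.≟ j′ p
  ... | yes jp≡ = jp≡
  ... | no jp≢ =
    ⊥-elim (0≢1+n (trans (sym (vecS-off j′ jp≢)) (trans (sym (v≡ (j p))) (vecS-on j p))))

  _+v[_]≡_ : Elt t k → (Fin t → Fin k) → Elt t k → Set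
  x +v[ j ]≡ e = ∀ p q → e p q ≡ x p q + vecS j p q

  AgreeBelow : ℕ → Elt t k → Elt t k → Set
  AgreeBelow n a b = ∀ p → toℕ p < n → ∀ q → a p q ≡ b p q

  agreeBelow-suc : ∀ {n a b} {N : Fin t} → toℕ N ≡ n →
    AgreeBelow n a b → (∀ q → a N q ≡ b N q) → AgreeBelow (suc n) a b
  agreeBelow-suc N≡n agree agreeN p p<1+n with m<1+n⇒m<n∨m≡n p<1+n
  ... | inj₁ p<n = agree p p<n
  ... | inj₂ p≡n rewrite toℕ-injective (trans p≡n (sym N≡n)) = agreeN

  agreeBelow-saturate : ∀ {n a b} → t ≤ n → AgreeBelow n a b → ∀ p q → a p q ≡ b p q
  agreeBelow-saturate t≤n agree p = agree p (<-≤-trans (toℕ<n p) t≤n)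

  private
    module Pos = IsStrictTotalOrder
      (×-isStrictTotalOrder (<ᶠ-isStrictTotalOrder {t}) (<ᶠ-isStrictTotalOrder {k}))

  _≺_ : Fin t × Fin k → Fin t × Fin k → Set
  _≺_ = ×-Lex _≡_ Fin._<_ Fin._<_

  ≺⇒block-≤ : ∀ {p q p′ q′} → (p , q) ≺ (p′ , q′) → toℕ p ≤ toℕ p′
  ≺⇒block-≤ (inj₁ p<p′) = <⇒≤ p<p′
  ≺⇒block-≤ (inj₂ (refl , _)) = ≤-refl

  <lex-at : ∀ {a b : Elt t k} N j → AgreeBelow (toℕ N) a b →
    (∀ q → q Fin.< j → a N q ≡ b N q) → a N j < b N j → a <lex b
  <lex-at {a} {b} N j agree agreeN a<b = N , j , earlier , a<b
    where
      earlier : ∀ p q → (p , q) ≺ (N , j) → a p q ≡ b p q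
      earlier p q (inj₁ p<N) = agree p p<N q
      earlier p q (inj₂ (refl , q<j)) = agreeN q q<j

  <lex-irrefl : ∀ {a : Elt t k} → ¬ a <lex a
  <lex-irrefl (_ , _ , _ , a<a) = <-irrefl refl a<a

  <lex-trans-block : ∀ {a b c : Elt t k} (ab : a <lex b) → b <lex c →
    Σ (a <lex c) λ ac → toℕ (proj₁ ac) ≤ toℕ (proj₁ ab)
  <lex-trans-block (p₁ , q₁ , before₁ , a<b) (p₂ , q₂ , before₂ , b<c)
    with Pos.compare (p₁ , q₁) (p₂ , q₂)
  ... | tri< ≺₂ _ _ =
    (p₁ , q₁ , (λ p q ≺₁ → trans (before₁ p q ≺₁) (before₂ p q (Pos.trans ≺₁ ≺₂))) ,
      <-≤-trans a<b (≤-reflexive (before₂ p₁ q₁ ≺₂))) , ≤-refl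
  ... | tri≈ _ (refl , refl) _ =
    (p₁ , q₁ , (λ p q ≺₁ → trans (before₁ p q ≺₁) (before₂ p q ≺₁)) , <-trans a<b b<c) , ≤-refl
  ... | tri> _ _ ≺₁ =
    (p₂ , q₂ , (λ p q ≺₂ → trans (before₁ p q (Pos.trans ≺₂ ≺₁)) (before₂ p q ≺₂)) ,
      ≤-<-trans (≤-reflexive (before₁ p₂ q₂ ≺₁)) b<c) , ≺⇒block-≤ ≺₁

  <lex-trans : ∀ {a b c : Elt t k} → a <lex b → b <lex c → a <lex c
  <lex-trans ab bc = proj₁ (<lex-trans-block ab bc)

  <lex-asym : ∀ {a b : Elt t k} → a <lex b → ¬ b <lex a
  <lex-asym ab ba = <lex-irrefl (<lex-trans ab ba)

  agreeBelow-<lex : ∀ {n a b} → AgreeBelow n a b → (ab : a <lex b) → n ≤ toℕ (proj₁ ab)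
  agreeBelow-<lex agree (p , q , _ , a<b) = ≮⇒≥ λ p<n → <-irrefl (agree p p<n q) a<b

  agreeBelow-between : ∀ {n} {a b c : Elt t k} → a <lex b → b <lex c →
    AgreeBelow n a c → AgreeBelow n a b
  agreeBelow-between ab@(p₁ , _ , before , _) bc agree p p<n q with p Fin.<? p₁
  ... | yes p<p₁ = before p q (inj₁ p<p₁)
  ... | no p≮p₁ with <lex-trans-block ab bc
  ...   | ac , ac≤ab =
    ⊥-elim (<⇒≱ (≤-<-trans (≮⇒≥ p≮p₁) p<n) (≤-trans (agreeBelow-<lex agree ac) ac≤ab))

  DivergesAt : Elt t k → Elt t k → Fin t → Set
  DivergesAt r₀ x N = r₀ <lex x × AgreeBelow (toℕ N) r₀ x × ¬ (∀ q → r₀ N q ≡ x N q)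

  FirstExcess : Elt t k → Elt t k → Fin t → Fin k → ℕ → Set
  FirstExcess r₀ x N j a =
    AgreeBelow (toℕ N) r₀ x × (∀ q → q Fin.< j → x N q ≡ r₀ N q) × x N j ≡ r₀ N j + a

  shift-agreeBelow : ∀ {n r₀ x e J M} → r₀ +v[ J ]≡ e → x +v[ M ]≡ e →
    AgreeBelow n r₀ x → ∀ p → toℕ p < n → M p ≡ J p
  shift-agreeBelow {r₀ = r₀} {x} {e} {J} {M} hJ hM agree p p<n =
    vecS-block-injective {j = M} {J} λ q → +-cancelˡ-≡ (x p q) _ _ (begin
      x p q + vecS M p q   ≡⟨ sym (hM p q) ⟩
      e p q                ≡⟨ hJ p q ⟩
      r₀ p q + vecS J p q  ≡⟨ cong (_+ vecS J p q) (agree p p<n q) ⟩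
      x p q + vecS J p q   ∎)
    where open ≡-Reasoning

  -- Block N of x + v[M] = r₀ + v[J] can differ from r₀ only at J N and M N, where x
  -- gains height J N and loses height M N; since x > r₀, the gain comes first.
  shift-firstExcess : ∀ {r₀ x e J M N} → r₀ +v[ J ]≡ e → x +v[ M ]≡ e →
    DivergesAt r₀ x N → FirstExcess r₀ x N (J N) (height J N)
  shift-firstExcess {r₀} {x} {e} {J} {M} {N} hJ hM (r₀<x , agree , differ) =
    agree , (λ q q<J → off (<⇒≢ᶠ (<-trans q<J J<M)) (<⇒≢ᶠ q<J)) , gain
    where
      open ≡-Reasoning
      block : ∀ q → x N q + vecS M N q ≡ r₀ N q + vecS J N q
      block q = trans (sym (hM N q)) (hJ N q)
      M≢J : M N ≢ J N
      M≢J M≡J = differ λ q → sym (+-cancelʳ-≡ (vecS M N q) _ _ (begin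
        x N q + vecS M N q   ≡⟨ block q ⟩
        r₀ N q + vecS J N q  ≡⟨ cong (r₀ N q +_) (vecS-block-cong {j = J} {M} (sym M≡J) J≡M-below q) ⟩
        r₀ N q + vecS M N q  ∎))
        where J≡M-below = height-cong (λ p p<N → sym (shift-agreeBelow hJ hM agree p p<N))
      off : ∀ {q} → q ≢ M N → q ≢ J N → x N q ≡ r₀ N q
      off {q} q≢M q≢J = +-cancelʳ-≡ 0 _ _ (begin
        x N q + 0            ≡⟨ cong (x N q +_) (sym (vecS-off M q≢M)) ⟩
        x N q + vecS M N q   ≡⟨ block q ⟩
        r₀ N q + vecS J N q  ≡⟨ cong (r₀ N q +_) (vecS-off J q≢J) ⟩
        r₀ N q + 0           ∎)
      gain : x N (J N) ≡ r₀ N (J N) + height J N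
      gain = +-cancelʳ-≡ 0 _ _ (begin
        x N (J N) + 0                ≡⟨ cong (x N (J N) +_) (sym (vecS-off M (M≢J ∘ sym))) ⟩
        x N (J N) + vecS M N (J N)   ≡⟨ block (J N) ⟩
        r₀ N (J N) + vecS J N (J N)  ≡⟨ cong (r₀ N (J N) +_) (vecS-on J N) ⟩
        r₀ N (J N) + height J N      ≡⟨ sym (+-identityʳ _) ⟩
        r₀ N (J N) + height J N + 0  ∎)
      loss : x N (M N) < r₀ N (M N)
      loss = <-≤-trans (m<m+n _ (s≤s z≤n)) (≤-reflexive (begin
        x N (M N) + height M N       ≡⟨ cong (x N (M N) +_) (sym (vecS-on M N)) ⟩
        x N (M N) + vecS M N (M N)   ≡⟨ block (M N) ⟩
        r₀ N (M N) + vecS J N (M N)  ≡⟨ cong (r₀ N (M N) +_) (vecS-off J M≢J) ⟩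
        r₀ N (M N) + 0               ≡⟨ +-identityʳ _ ⟩
        r₀ N (M N)                   ∎))
      J<M : J N Fin.< M N
      J<M with <-cmpᶠ (J N) (M N)
      ... | tri< J<M _ _ = J<M
      ... | tri≈ _ J≡M _ = ⊥-elim (M≢J (sym J≡M))
      ... | tri> _ _ M<J = ⊥-elim (<lex-asym r₀<x (<lex-at N (M N) (λ p p<N q → sym (agree p p<N q))
             (λ q q<M → off (<⇒≢ᶠ q<M) (<⇒≢ᶠ (<-trans q<M M<J))) loss))

  firstExcess-<lex : ∀ {r₀ u w N j j′ a a′} → FirstExcess r₀ u N j a → FirstExcess r₀ w N j′ a′ →
    0 < a → (j Fin.< j′ ⊎ (j ≡ j′ × a′ < a)) → w <lex u
  firstExcess-<lex {N = N} {j} (agree-u , below-u , at-u) (agree-w , below-w , at-w) 0<a (inj₁ j<j′) =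
    <lex-at N j (λ p p<N q → trans (sym (agree-w p p<N q)) (agree-u p p<N q))
      (λ q q<j → trans (below-w q (<-trans q<j j<j′)) (sym (below-u q q<j)))
      (subst₂ _<_ (sym (below-w j j<j′)) (sym at-u) (m<m+n _ 0<a))
  firstExcess-<lex {N = N} {j} (agree-u , below-u , at-u) (agree-w , below-w , at-w) _
    (inj₂ (refl , a′<a)) =
    <lex-at N j (λ p p<N q → trans (sym (agree-w p p<N q)) (agree-u p p<N q))
      (λ q q<j → trans (below-w q q<j) (sym (below-u q q<j)))
      (subst₂ _<_ (sym at-w) (sym at-u) (+-monoʳ-< _ a′<a))

  shifts-agree-on-block : ∀ {r₀ c d J J′ U} → r₀ +v[ J ]≡ c → r₀ +v[ J′ ]≡ d →
    (∀ p → toℕ p ≤ toℕ U → J p ≡ J′ p) → ∀ q → c U q ≡ d U q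
  shifts-agree-on-block {r₀} {c} {d} {J} {J′} {U} hc hd J≡J′ q = begin
    c U q                 ≡⟨ hc U q ⟩
    r₀ U q + vecS J U q   ≡⟨ cong (r₀ U q +_) (vecS-block-cong {j = J} {J′} (J≡J′ U ≤-refl) height≡ q) ⟩
    r₀ U q + vecS J′ U q  ≡⟨ sym (hd U q) ⟩
    d U q                 ∎
    where
      open ≡-Reasoning
      height≡ : height J U ≡ height J′ U
      height≡ = height-cong (λ p p<U → J≡J′ p (<⇒≤ p<U))

  -- (J N , height J N) is the key with which rows below c = r₀ + v[J] first exceed r₀ in block N.
  shift-keys-differ : ∀ {r₀ c d J J′ U N} → r₀ +v[ J ]≡ c → r₀ +v[ J′ ]≡ d →
    ¬ (∀ q → c U q ≡ d U q) → toℕ U ≤ toℕ N → ¬ (J N ≡ J′ N × height J N ≡ height J′ N)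
  shift-keys-differ {J = J} {J′} {U} {N} hc hd c≢d U≤N (JN≡ , height≡) =
    c≢d (shifts-agree-on-block hc hd (λ p p≤U → J≡J′ p (≤-trans p≤U U≤N)))
    where
      J≡J′ : ∀ p → toℕ p ≤ toℕ N → J p ≡ J′ p
      J≡J′ p p≤N with m≤n⇒m<n∨m≡n p≤N
      ... | inj₁ p<N = height-injective height≡ p p<N
      ... | inj₂ p≡N rewrite toℕ-injective p≡N = JN≡

  firstExcess-between : ∀ {r₀ x y y′ N j j′ a a′} →
    FirstExcess r₀ y N j′ a′ → FirstExcess r₀ x N j a → FirstExcess r₀ y′ N j′ a′ →
    0 < a → 0 < a′ → ¬ (j ≡ j′ × a ≡ a′) → y <lex x → ¬ x <lex y′
  firstExcess-between {j = j} {j′} {a} {a′} ey ex ey′ 0<a 0<a′ keys≢ y<x x<y′ with <-cmpᶠ j j′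
  ... | tri< j<j′ _ _ = <lex-asym x<y′ (firstExcess-<lex ex ey′ 0<a (inj₁ j<j′))
  ... | tri> _ _ j>j′ = <lex-asym y<x (firstExcess-<lex ey ex 0<a′ (inj₁ j>j′))
  ... | tri≈ _ refl _ with <-cmp a a′
  ...   | tri< a<a′ _ _ = <lex-asym y<x (firstExcess-<lex ey ex 0<a′ (inj₂ (refl , a<a′)))
  ...   | tri≈ _ a≡a′ _ = keys≢ (refl , a≡a′)
  ...   | tri> _ _ a>a′ = <lex-asym x<y′ (firstExcess-<lex ex ey′ 0<a (inj₂ (refl , a>a′)))

  c-row-not-between : ∀ {r₀ c d x y y′ J J′ M P P′ U N} → r₀ +v[ J ]≡ c → r₀ +v[ J′ ]≡ d →
    ¬ (∀ q → c U q ≡ d U q) → toℕ U ≤ toℕ N →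
    y +v[ P ]≡ d → x +v[ M ]≡ c → y′ +v[ P′ ]≡ d →
    DivergesAt r₀ y N → DivergesAt r₀ x N → DivergesAt r₀ y′ N → y <lex x → ¬ x <lex y′
  c-row-not-between hc hd c≢d U≤N hy hx hy′ dy dx dy′ =
    firstExcess-between
      (shift-firstExcess hd hy dy) (shift-firstExcess hc hx dx) (shift-firstExcess hd hy′ dy′)
      (s≤s z≤n) (s≤s z≤n) (shift-keys-differ hc hd c≢d U≤N)

  agreement-propagates-at : ∀ {r₀ c d x y z J J′ M P P′ U N} → r₀ +v[ J ]≡ c → r₀ +v[ J′ ]≡ d →
    ¬ (∀ q → c U q ≡ d U q) → toℕ U ≤ toℕ N →
    y +v[ P ]≡ d → x +v[ M ]≡ c → z +v[ P′ ]≡ d →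
    r₀ <lex y → y <lex x → x <lex z → AgreeBelow (toℕ N) r₀ z → AgreeBelow (suc (toℕ N)) r₀ y
  agreement-propagates-at {r₀} {x = x} {y} {z} {N = N} hc hd c≢d U≤N hy hx hz r₀<y y<x x<z agree-z =
    agreeBelow-suc refl agree-y (decidable-stable (all? λ q → r₀ N q ≟ y N q) λ y-differs →
      c-row-not-between hc hd c≢d U≤N hy hx hz
        (r₀<y , agree-y , y-differs)
        (<lex-trans r₀<y y<x , agree-x , later-differs y-differs agree-x y<x)
        (<lex-trans r₀<y y<z , agree-z , later-differs y-differs agree-z y<z) y<x x<z)
    where
      y<z : y <lex z
      y<z = <lex-trans y<x x<z
      agree-x : AgreeBelow (toℕ N) r₀ x
      agree-x = agreeBelow-between (<lex-trans r₀<y y<x) x<z agree-z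
      agree-y : AgreeBelow (toℕ N) r₀ y
      agree-y = agreeBelow-between r₀<y y<x agree-x
      later-differs : ∀ {w} → ¬ (∀ q → r₀ N q ≡ y N q) →
        AgreeBelow (toℕ N) r₀ w → y <lex w → ¬ (∀ q → r₀ N q ≡ w N q)
      later-differs y-differs agree-w y<w same =
        y-differs (agreeBelow-between r₀<y y<w (agreeBelow-suc refl agree-w same) N (n<1+n _))

  agreement-propagates : ∀ {n r₀ c d x y z J J′ M P P′ U} → r₀ +v[ J ]≡ c → r₀ +v[ J′ ]≡ d →
    ¬ (∀ q → c U q ≡ d U q) → toℕ U ≤ n →
    y +v[ P ]≡ d → x +v[ M ]≡ c → z +v[ P′ ]≡ d →
    r₀ <lex y → y <lex x → x <lex z → AgreeBelow n r₀ z → AgreeBelow (suc n) r₀ y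
  agreement-propagates {n} hc hd c≢d U≤n hy hx hz r₀<y y<x x<z agree-z with n <? t
  ... | no n≮t = λ p _ → agreeBelow-saturate (≮⇒≥ n≮t)
                           (agreeBelow-between r₀<y (<lex-trans y<x x<z) agree-z) p
  ... | yes n<t with fromℕ< n<t | toℕ-fromℕ< n<t
  ...   | N | refl = agreement-propagates-at hc hd c≢d U≤n hy hx hz r₀<y y<x x<z agree-z

-- With 0-based rows, the odd rows lie below d and the even rows other than 0 below c.
Q-odd : ∀ m → Q (suc (m * 2)) (suc zero) ≡ true
Q-odd zero = refl
Q-odd (suc m) = Q-odd m

Q-even : ∀ m → Q (suc (suc (m * 2))) zero ≡ true
Q-even zero = refl
Q-even (suc m) = Q-even m

private
  last-odd-identity : ∀ m → suc (m * 2) + 1 ≡ 2 * suc (m + 0)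
  last-odd-identity = solve-∀

  double-identity : ∀ m s → 2 * suc (m + suc s) ≡ 4 + m * 2 + s * 2
  double-identity = solve-∀

odd-row-bound : ∀ m s → 3 + m * 2 < 2 * suc (m + suc s)
odd-row-bound m s = subst (4 + m * 2 ≤_) (sym (double-identity m s)) (m≤m+n (4 + m * 2) (s * 2))

module Occurrence {t k : ℕ} (r : Fin (2 * t) → Elt t k) {c d : Elt t k}
  (r-increasing : ∀ i j → i Fin.< j → r i <lex r j)
  (c-rows : ∀ i → Q (toℕ i) zero ≡ true → Adj (r i) c)
  (d-rows : ∀ i → Q (toℕ i) (suc zero) ≡ true → Adj (r i) d)
  (i₀ iₗ : Fin (2 * t)) (i₀≡0 : toℕ i₀ ≡ 0) (iₗ-last : toℕ iₗ + 1 ≡ 2 * t)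
  {U : Fin t} (c≢d : ¬ (∀ q → c U q ≡ d U q))
  where

  row : (n : ℕ) → .(n < 2 * t) → Elt t k
  row n n< = r (fromℕ< n<)

  r₀ : Elt t k
  r₀ = r i₀

  row-<lex : ∀ {m n} .(m< : m < 2 * t) .(n< : n < 2 * t) → m < n → row m m< <lex row n n<
  row-<lex m< n< m<n =
    r-increasing _ _ (subst₂ _<_ (sym (toℕ-fromℕ< m<)) (sym (toℕ-fromℕ< n<)) m<n)

  r₀<row : ∀ {n} .(n< : suc n < 2 * t) → r₀ <lex row (suc n) n<
  r₀<row n< = r-increasing _ _ (subst₂ _<_ (sym i₀≡0) (sym (toℕ-fromℕ< n<)) (s≤s z≤n))

  c-row : ∀ {n} .(n< : n < 2 * t) → Q n zero ≡ true → Adj (row n n<) c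
  c-row n< Qn = c-rows _ (subst (λ i → Q i zero ≡ true) (sym (toℕ-fromℕ< n<)) Qn)

  d-row : ∀ {n} .(n< : n < 2 * t) → Q n (suc zero) ≡ true → Adj (row n n<) d
  d-row n< Qn = d-rows _ (subst (λ i → Q i (suc zero) ≡ true) (sym (toℕ-fromℕ< n<)) Qn)

  base-c : Adj r₀ c
  base-c = c-rows i₀ (subst (λ i → Q i zero ≡ true) (sym i₀≡0) refl)

  base-d : Adj r₀ d
  base-d = d-rows i₀ (subst (λ i → Q i (suc zero) ≡ true) (sym i₀≡0) refl)

  odd-rows-agree : ∀ {n} → toℕ U ≤ n → AgreeBelow n r₀ (r iₗ) →
    ∀ s m .(m< : suc (m * 2) < 2 * t) → suc (m + s) ≡ t →
    AgreeBelow (n + s) r₀ (row (suc (m * 2)) m<)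
  odd-rows-agree {n} _ agree-last zero m m< m+1≡t rewrite +-identityʳ n =
    subst (AgreeBelow n r₀ ∘ r) (sym (toℕ-injective (trans (toℕ-fromℕ< m<) last))) agree-last
    where
      last : suc (m * 2) ≡ toℕ iₗ
      last = +-cancelʳ-≡ 1 _ _ (trans (last-odd-identity m) (trans (cong (2 *_) m+1≡t) (sym iₗ-last)))
  odd-rows-agree {n} U≤n agree-last (suc s) m m< eq rewrite +-suc n s =
    agreement-propagates (proj₂ base-c) (proj₂ base-d) c≢d (≤-trans U≤n (m≤m+n n s))
      (proj₂ (d-row m< (Q-odd m))) (proj₂ (c-row x< (Q-even m))) (proj₂ (d-row z< (Q-odd (suc m))))
      (r₀<row m<) (row-<lex m< x< ≤-refl) (row-<lex x< z< ≤-refl)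
      (odd-rows-agree U≤n agree-last s (suc m) z< (trans (cong suc (sym (+-suc m s))) eq))
    where
      z< : 3 + m * 2 < 2 * t
      z< = subst (λ t → 3 + m * 2 < 2 * t) eq (odd-row-bound m s)
      x< : 2 + m * 2 < 2 * t
      x< = <-trans (n<1+n _) z<

lemma5 : (t k : ℕ) → 2 ≤ t → 1 ≤ k →
    (r : Fin (2 * t) → Elt t k) → (c d : Elt t k) →
    (∀ i → InI t k (r i)) → InI t k c → InI t k d →
    (∀ i j → i Fin.< j → r i <lex r j) → c <lex d →
    (∀ i → Q (toℕ i) zero ≡ true → Adj (r i) c) →
    (∀ i → Q (toℕ i) (suc zero) ≡ true → Adj (r i) d) →
    (i₀ iₗ : Fin (2 * t)) → toℕ i₀ ≡ 0 → toℕ iₗ + 1 ≡ 2 * t →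
    (T U : Fin t) → IsType (r i₀) (r iₗ) T → IsType c d U →
    toℕ U ≤ toℕ T →
    toℕ T ≡ 0 × toℕ U ≡ 0
lemma5 (suc t′) k (s≤s _) _ r c d _ _ _ r-increasing _ c-rows d-rows i₀ iₗ i₀≡0 iₗ-last T U
  (_ , agree-last) (c≢d , _) U≤T = T≡0 , n≤0⇒n≡0 (subst (toℕ U ≤_) T≡0 U≤T)
  where
    open Occurrence r r-increasing c-rows d-rows i₀ iₗ i₀≡0 iₗ-last c≢d
    1<2t : 1 < 2 * suc t′
    1<2t = *-monoʳ-≤ 2 (s≤s z≤n)
    -- if T ≥ 1, the second row would agree with r₀ on all t blocks
    T≡0 : toℕ T ≡ 0
    T≡0 = n<1⇒n≡0 (≰⇒> λ 1≤T → <⇒≱ (toℕ<n (proj₁ (r₀<row 1<2t)))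
      (≤-trans (+-monoˡ-≤ t′ 1≤T)
        (agreeBelow-<lex (odd-rows-agree U≤T agree-last t′ 0 1<2t refl) (r₀<row 1<2t))))
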